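{- Let $A \subset B$ be commutative rings with $1$ such that the index $[B:A]$ (of $A$ in $B$ as additive groups) is finite. Let $\alpha \in B$, and let $n$ be the smallest positive integer such that $n\alpha \in A$. Suppose $n$ has prime factorization $n = \ell_1^{d_1}\cdots \ell_r^{d_r}$ with distinct primes $\ell_i$. Then \[ A[\alpha] = A\Big[\tfrac{n}{\ell_1^{d_1}}\alpha, \ldots, \tfrac{n}{\ell_r^{d_r}}\alpha\Big]. \] -}

module Defs where

open import Level using (Level; _⊔_)
open import Data.Nat using (ℕ; _/_; _^_)
open import Data.Nat.Properties using (m^n≢0)
open import Data.Nat.Primality using (Prime; prime⇒nonZero)
open import Data.Fin using (Fin)
open import Data.Product using (Σ; ∃; _,_)
open import Relation.Unary using (Pred)
open import Algebra.Bundles using (CommutativeRing)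
import Algebra.Properties.Monoid.Mult as Mult

cofactor : (n ℓ d : ℕ) → Prime ℓ → ℕ
cofactor n ℓ d pr = _/_ n (ℓ ^ d) {{m^n≢0 ℓ d {{prime⇒nonZero pr}}}}

module _ {c ℓ} (R : CommutativeRing c ℓ) where
  open CommutativeRing R

  _·_ : ℕ → Carrier → Carrier
  _·_ = Mult._×_ +-monoid

  record IsSubring {p} (A : Pred Carrier p) : Set (c ⊔ ℓ ⊔ p) where
    field
      resp : ∀ {x y} → x ≈ y → A x → A y
      has-0 : A 0#
      has-1 : A 1#
      +-closed : ∀ {x y} → A x → A y → A (x + y)
      neg-closed : ∀ {x} → A x → A (- x)
      *-closed : ∀ {x y} → A x → A y → A (x * y)

  -- [B : A] finite: finitely many cosets b + A cover B
  FiniteIndex : ∀ {p} → Pred Carrier p → Set (c ⊔ p)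
  FiniteIndex A = Σ ℕ λ k → Σ (Fin k → Carrier) λ reps →
                    ∀ b → ∃ λ i → A (b - reps i)

  data Adjoin {p i} (A : Pred Carrier p) {J : Set i} (g : J → Carrier)
              : Pred Carrier (c ⊔ ℓ ⊔ p ⊔ i) where
    base : ∀ {x} → A x → Adjoin A g x
    gen  : ∀ j → Adjoin A g (g j)
    add  : ∀ {x y} → Adjoin A g x → Adjoin A g y → Adjoin A g (x + y)
    neg  : ∀ {x} → Adjoin A g x → Adjoin A g (- x)
    mul  : ∀ {x y} → Adjoin A g x → Adjoin A g y → Adjoin A g (x * y)
    resp : ∀ {x y} → x ≈ y → Adjoin A g x → Adjoin A g y

-- Let c_i = n / ℓ_i^{d_i}. The set of m with m α ∈ A[c_1 α, …, c_r α] is closed under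
-- multiples and differences, hence under gcd by Bézout, and it contains n and every c_i.
-- Since c_i is coprime to ℓ_i^{d_i}, a common divisor of n and all c_i is coprime to every
-- ℓ_i^{d_i}, hence to their product n, so it is 1. Thus α = 1 α ∈ A[c_1 α, …, c_r α]; the
-- other inclusion is clear.
module Submission where

open import Defs
open import Data.Nat using (ℕ; _<_; _^_; NonZero; zero; suc; _+_; _*_; _/_)
open import Data.Nat.Primality using (Prime; prime⇒irreducible; ¬prime[1]; prime⇒nonZero)
open import Data.Nat.Properties using (*-comm; *-commutativeSemigroup; m^n≢0)
open import Data.Nat.Divisibility using (_∣_; ∣-refl; ∣-trans; ∣1⇒≡1)
open import Data.Nat.DivMod using (m*n/n≡m)
open import Data.Nat.Coprimality using (Coprime; coprime-divisor)
import Data.Nat.Coprimality as Coprime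
open import Data.Nat.GCD using (gcd; gcd-GCD; gcd[m,n]∣m; gcd[m,n]∣n; module Bézout)
open import Data.Fin using (Fin; zero; suc; punchIn)
open import Data.Fin.Properties using (punchInᵢ≢i)
open import Data.List using (tabulate)
open import Data.Nat.ListAction using (product)
open import Data.Unit using (⊤; tt)
open import Data.Product using (_×_; _,_; Σ)
open import Data.Sum using (inj₁; inj₂)
open import Data.Empty using (⊥-elim)
open import Function using (_∘_)
open import Relation.Nullary using (¬_)
open import Relation.Unary using (Pred; _⊆_)
open import Relation.Binary.PropositionalEquality
  using (_≡_; _≢_; refl; sym; trans; cong; subst; module ≡-Reasoning)
open import Function.Definitions using (Injective)
open import Algebra.Bundles using (CommutativeRing)
import Algebra.Properties.Monoid.Mult as Mult
open import Algebra.Properties.CommutativeSemigroup *-commutativeSemigroup using (x∙yz≈y∙xz)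

private
  variable
    a b r x : ℕ

coprime-1 : Coprime x 1
coprime-1 (_ , d∣1) = ∣1⇒≡1 d∣1

coprime-* : Coprime x a → Coprime x b → Coprime x (a * b)
coprime-* x⊥a x⊥b (d∣x , d∣ab) =
  x⊥b (d∣x , coprime-divisor (λ (e∣d , e∣a) → x⊥a (∣-trans e∣d d∣x , e∣a)) d∣ab)

coprime-^ : ∀ k → Coprime x a → Coprime x (a ^ k)
coprime-^ zero    x⊥a = coprime-1
coprime-^ (suc k) x⊥a = coprime-* x⊥a (coprime-^ k x⊥a)

coprime-product : (f : Fin r → ℕ) → (∀ j → Coprime x (f j)) → Coprime x (product (tabulate f))
coprime-product {zero}  f x⊥f = coprime-1
coprime-product {suc r} f x⊥f = coprime-* (x⊥f zero) (coprime-product (f ∘ suc) (x⊥f ∘ suc))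

distinct-primes-coprime : ∀ {p q} → Prime p → Prime q → p ≢ q → Coprime p q
distinct-primes-coprime p-prime q-prime p≢q (d∣p , d∣q) with prime⇒irreducible p-prime d∣p
... | inj₁ d≡1 = d≡1
... | inj₂ refl with prime⇒irreducible q-prime d∣q
...   | inj₁ refl = ⊥-elim (¬prime[1] p-prime)
...   | inj₂ p≡q  = ⊥-elim (p≢q p≡q)

distinct-prime-powers-coprime : ∀ {p q} j k → Prime p → Prime q → p ≢ q → Coprime (p ^ j) (q ^ k)
distinct-prime-powers-coprime j k p-prime q-prime p≢q =
  coprime-^ k (Coprime.sym (coprime-^ j (Coprime.sym (distinct-primes-coprime p-prime q-prime p≢q))))

product-tabulate-punchIn : (f : Fin (suc r) → ℕ) (i : Fin (suc r)) →
                           product (tabulate f) ≡ f i * product (tabulate (f ∘ punchIn i))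
product-tabulate-punchIn         f zero    = refl
product-tabulate-punchIn {suc r} f (suc i) = begin
  f zero * product (tabulate (f ∘ suc))
    ≡⟨ cong (f zero *_) (product-tabulate-punchIn (f ∘ suc) i) ⟩
  f zero * (f (suc i) * product (tabulate (f ∘ suc ∘ punchIn i)))
    ≡⟨ x∙yz≈y∙xz (f zero) (f (suc i)) _ ⟩
  f (suc i) * (f zero * product (tabulate (f ∘ suc ∘ punchIn i))) ∎
  where open ≡-Reasoning

PairwiseCoprime : (Fin r → ℕ) → Set
PairwiseCoprime q = ∀ {i j} → i ≢ j → Coprime (q i) (q j)

cofactor-coprime : (q : Fin r → ℕ) {{q≢0 : ∀ {i} → NonZero (q i)}} → PairwiseCoprime q →
                   ∀ i → Coprime (product (tabulate q) / q i) (q i)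
cofactor-coprime {suc r} q q-coprime i =
  subst (λ c → Coprime c (q i)) (sym cofactor≡rest) (Coprime.sym q-i⊥rest)
  where
  rest : ℕ
  rest = product (tabulate (q ∘ punchIn i))
  q-i⊥rest : Coprime (q i) rest
  q-i⊥rest = coprime-product (q ∘ punchIn i) (λ j → q-coprime (punchInᵢ≢i i j ∘ sym))
  cofactor≡rest : product (tabulate q) / q i ≡ rest
  cofactor≡rest = trans (cong (_/ q i) (trans (product-tabulate-punchIn q i) (*-comm (q i) rest)))
                        (m*n/n≡m rest (q i))

∣-cofactors⇒≡1 : ∀ {e} (q : Fin r → ℕ) {{q≢0 : ∀ {i} → NonZero (q i)}} → PairwiseCoprime q →
                 e ∣ product (tabulate q) → (∀ i → e ∣ product (tabulate q) / q i) → e ≡ 1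
∣-cofactors⇒≡1 {e = e} q q-coprime e∣n e∣cofactor = coprime-product q e⊥q (∣-refl , e∣n)
  where
  e⊥q : ∀ i → Coprime e (q i)
  e⊥q i (d∣e , d∣q) = cofactor-coprime q q-coprime i (∣-trans d∣e (e∣cofactor i) , d∣q)

GcdClosed : ∀ {p} → Pred ℕ p → Set p
GcdClosed P = ∀ a b → P a → P b → P (gcd a b)

module _ {p} {P : Pred ℕ p} where

  multiple-difference-closed⇒gcdClosed : (∀ k a → P a → P (k * a)) →
                                          (∀ a b → P (a + b) → P b → P a) → GcdClosed P
  multiple-difference-closed⇒gcdClosed *-closed cancel a b Pa Pb
    with Bézout.identity (gcd-GCD a b)
  ... | Bézout.+- x y eq = cancel _ (y * b) (subst P (sym eq) (*-closed x a Pa)) (*-closed y b Pb)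
  ... | Bézout.-+ x y eq = cancel _ (x * a) (subst P (sym eq) (*-closed y b Pb)) (*-closed x a Pa)

  gcdClosed⇒common-divisor : GcdClosed P → ∀ {n} (c : Fin r → ℕ) → P n → (∀ i → P (c i)) →
                             Σ ℕ λ g → P g × g ∣ n × (∀ i → g ∣ c i)
  gcdClosed⇒common-divisor {zero}  P-gcd c Pn Pc = _ , Pn , ∣-refl , λ ()
  gcdClosed⇒common-divisor {suc r} P-gcd c Pn Pc
    with g , Pg , g∣n , g∣c ← gcdClosed⇒common-divisor P-gcd (c ∘ suc) Pn (Pc ∘ suc) =
    gcd (c zero) g , P-gcd (c zero) g (Pc zero) Pg , ∣-trans (gcd[m,n]∣n (c zero) g) g∣n , gcd∣c
    where
    gcd∣c : ∀ i → gcd (c zero) g ∣ c i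
    gcd∣c zero    = gcd[m,n]∣m (c zero) g
    gcd∣c (suc i) = ∣-trans (gcd[m,n]∣n (c zero) g) (g∣c i)

module _ {c ℓ p} (B : CommutativeRing c ℓ) {A : Pred (CommutativeRing.Carrier B) p} where
  open CommutativeRing B renaming (_+_ to _⊕_) hiding (sym; refl; trans)
  open Mult +-monoid using (×-homo-1; ×-homo-+; ×-assocˡ)
  open import Relation.Binary.Reasoning.Setoid setoid

  Adjoin-⊆ : ∀ {i j} {J : Set i} {K : Set j} {g : J → Carrier} {h : K → Carrier} →
             (∀ k → Adjoin B A h (g k)) → Adjoin B A g ⊆ Adjoin B A h
  Adjoin-⊆ g⊆ (base a)   = base a
  Adjoin-⊆ g⊆ (gen k)    = g⊆ k
  Adjoin-⊆ g⊆ (add x y)  = add (Adjoin-⊆ g⊆ x) (Adjoin-⊆ g⊆ y)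
  Adjoin-⊆ g⊆ (neg x)    = neg (Adjoin-⊆ g⊆ x)
  Adjoin-⊆ g⊆ (mul x y)  = mul (Adjoin-⊆ g⊆ x) (Adjoin-⊆ g⊆ y)
  Adjoin-⊆ g⊆ (resp e x) = resp e (Adjoin-⊆ g⊆ x)

  module _ (A-subring : IsSubring B A) {i} {J : Set i} {g : J → Carrier} where

    Adjoin-· : ∀ m {x} → Adjoin B A g x → Adjoin B A g (_·_ B m x)
    Adjoin-· zero    _ = base (IsSubring.has-0 A-subring)
    Adjoin-· (suc m) x = add x (Adjoin-· m x)

    Adjoin-multiples-gcdClosed : ∀ α → GcdClosed (λ m → Adjoin B A g (_·_ B m α))
    Adjoin-multiples-gcdClosed α = multiple-difference-closed⇒gcdClosed
      (λ k a a·α∈ → resp (×-assocˡ α k a) (Adjoin-· k a·α∈))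
      (λ a b [a+b]·α∈ b·α∈ → resp (cancel a b) (add [a+b]·α∈ (neg b·α∈)))
      where
      cancel : ∀ a b → _·_ B (a + b) α ⊕ - _·_ B b α ≈ _·_ B a α
      cancel a b = begin
        _·_ B (a + b) α ⊕ - _·_ B b α              ≈⟨ +-congʳ (×-homo-+ α a b) ⟩
        (_·_ B a α ⊕ _·_ B b α) ⊕ - _·_ B b α      ≈⟨ +-assoc _ _ _ ⟩
        _·_ B a α ⊕ (_·_ B b α ⊕ - _·_ B b α)      ≈⟨ +-congˡ (-‿inverseʳ _) ⟩
        _·_ B a α ⊕ 0#                             ≈⟨ +-identityʳ _ ⟩
        _·_ B a α                                  ∎

    Adjoin-coprime-multiples : ∀ α {n} (c : Fin r → ℕ) →
                               Adjoin B A g (_·_ B n α) → (∀ i → Adjoin B A g (_·_ B (c i) α)) →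
                               (∀ {e} → e ∣ n → (∀ i → e ∣ c i) → e ≡ 1) → Adjoin B A g α
    Adjoin-coprime-multiples α c n·α∈ c·α∈ common-divisor≡1
      with e , e·α∈ , e∣n , e∣c ← gcdClosed⇒common-divisor (Adjoin-multiples-gcdClosed α) c n·α∈ c·α∈
      = resp (×-homo-1 α) (subst (λ m → Adjoin B A g (_·_ B m α)) (common-divisor≡1 e∣n e∣c) e·α∈)

lemma3p2 : ∀ {c ℓ' p} (B : CommutativeRing c ℓ') (A : Pred (CommutativeRing.Carrier B) p) →
             IsSubring B A → FiniteIndex B A →
             (α : CommutativeRing.Carrier B) (n : ℕ) → NonZero n → A (_·_ B n α) →
             (∀ m → NonZero m → m < n → ¬ A (_·_ B m α)) →
             (r : ℕ) (ℓ d : Fin r → ℕ) (prime : ∀ i → Prime (ℓ i)) → (∀ i → NonZero (d i)) →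
             Injective _≡_ _≡_ ℓ → product (tabulate (λ i → ℓ i ^ d i)) ≡ n →
             ∀ x → (Adjoin B A {J = ⊤} (λ _ → α) x → Adjoin B A (λ i → _·_ B (cofactor n (ℓ i) (d i) (prime i)) α) x)
                 × (Adjoin B A (λ i → _·_ B (cofactor n (ℓ i) (d i) (prime i)) α) x → Adjoin B A {J = ⊤} (λ _ → α) x)
-- Finite index, minimality of n and d i ≠ 0 are not needed: only n α ∈ A is used.
lemma3p2 B A A-subring _ α n _ n·α∈A _ r ℓ d prime _ ℓ-injective refl x =
  Adjoin-⊆ B (λ _ → α∈A[c·α]) , Adjoin-⊆ B (λ i → Adjoin-· B A-subring (c i) (gen tt))
  where
  q : Fin r → ℕ
  q i = ℓ i ^ d i
  instance
    q≢0 : ∀ {i} → NonZero (q i)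
    q≢0 {i} = m^n≢0 (ℓ i) (d i) {{prime⇒nonZero (prime i)}}
  c : Fin r → ℕ
  c i = cofactor (product (tabulate q)) (ℓ i) (d i) (prime i)
  q-coprime : PairwiseCoprime q
  q-coprime {i} {j} i≢j = distinct-prime-powers-coprime (d i) (d j) (prime i) (prime j) (i≢j ∘ ℓ-injective)
  α∈A[c·α] : Adjoin B A (λ i → _·_ B (c i) α) α
  α∈A[c·α] = Adjoin-coprime-multiples B A-subring α c (base n·α∈A) gen (∣-cofactors⇒≡1 q q-coprime)
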